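{- Let $n\ge1$, $d\ge 0$, $k\ge1$ be integers and $F:\{0,1\}^n\to\{0,1\}$. Then: (1) $\gamma_{d,k}(F)\ge \frac12$; (2) $\gamma_{d,k+1}(F)\ge\gamma_{d,k}(F)$; (3) if $\gamma_{d,k}(F)>1-\frac{1}{2^d}$, then $\gamma_{d,k}(F)=\gamma_{d,1}(F)$; (4) $\gamma_{1,k}(F)=\gamma_{1,1}(F)$.
   Context: For a Boolean function $F:\{0,1\}^n\to\{0,1\}$ and $k\ge 1$, the $k$-lift of $F$ is $F_k:\{0,1\}^n\to \mathbb{Z}/2^k\mathbb{Z}$ with $F_k(x)=0$ if $F(x)=0$ and $F_k(x)=2^{k-1}$ if $F(x)=1$. $\mathcal{P}_{d,k}$ denotes the set of multilinear polynomials in $x_1,\dots,x_n$ of degree at most $d$ with coefficients in $\mathbb{Z}/2^k\mathbb{Z}$, evaluated on $\{0,1\}^n$. $\mathrm{agr}(F,G)=\Pr_{x}[F(x)=G(x)]$ for $x$ uniform in $\{0,1\}^n$, and $\gamma_{d,k}(F)=\max_{Q\in\mathcal{P}_{d,k}}\mathrm{agr}(F_k,Q)$. -}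

module Defs where

open import Data.Nat using (ℕ; zero; suc; _+_; _*_; _∸_; _^_; _≤?_; _%_; _⊔_)
open import Data.Nat.Properties using (_≟_; m^n≢0)
open import Data.Nat.ListAction using (sum)
open import Data.Bool using (Bool; true; false; if_then_else_)
open import Data.List using (List; []; _∷_; concatMap; filter; map; length; foldr; zipWith; upTo)
open import Data.Vec using (Vec; []; _∷_)

-- A point of {0,1}^n is a Vec Bool n (true = 1).
-- The whole cube {0,1}^n, each point listed exactly once.
cube : (n : ℕ) → List (Vec Bool n)
cube zero    = [] ∷ []
cube (suc n) = concatMap (λ v → (false ∷ v) ∷ (true ∷ v) ∷ []) (cube n)

weight : {n : ℕ} → Vec Bool n → ℕ
weight []           = 0
weight (false ∷ v)  = weight v
weight (true ∷ v)   = suc (weight v)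

-- Multilinear monomials are indexed by subsets S ⊆ [n] (as characteristic vectors).
-- Value of the monomial  ∏_{i ∈ S} x_i  at the point x.
monoVal : {n : ℕ} → Vec Bool n → Vec Bool n → ℕ
monoVal []          []          = 1
monoVal (false ∷ S) (_ ∷ x)     = monoVal S x
monoVal (true ∷ S)  (b ∷ x)     = (if b then 1 else 0) * monoVal S x

monomials : (d n : ℕ) → List (Vec Bool n)
monomials d n = filter (λ S → weight S ≤? d) (cube n)

vectorsBelow : (q m : ℕ) → List (List ℕ)
vectorsBelow q zero    = [] ∷ []
vectorsBelow q (suc m) = concatMap (λ c → map (c ∷_) (vectorsBelow q m)) (upTo q)

-- A polynomial in P_{d,k}: a coefficient in Z/2^k (represented by 0,…,2^k-1)
-- for each monomial of degree ≤ d.  The list of all of them: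
polys : (d k n : ℕ) → List (List ℕ)
polys d k n = vectorsBelow (2 ^ k) (length (monomials d n))

evalPoly : (d k : ℕ) {n : ℕ} → List ℕ → Vec Bool n → ℕ
evalPoly d k {n} cs x =
  _%_ (sum (zipWith (λ S c → c * monoVal S x) (monomials d n) cs)) (2 ^ k) {{m^n≢0 2 k}}

liftk : (k : ℕ) → Bool → ℕ
liftk k false = 0
liftk k true  = 2 ^ (k ∸ 1)

-- 2^n · agr(F_k, Q): number of points x with F_k(x) = Q(x).
agrCount : (d k : ℕ) {n : ℕ} → (Vec Bool n → Bool) → List ℕ → ℕ
agrCount d k {n} F cs =
  length (filter (λ x → liftk k (F x) ≟ evalPoly d k cs x) (cube n))

-- 2^n · γ_{d,k}(F): maximum of agrCount over all Q ∈ P_{d,k}.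
gammaCount : (d k : ℕ) {n : ℕ} → (Vec Bool n → Bool) → ℕ
gammaCount d k {n} F = foldr _⊔_ 0 (map (agrCount d k F) (polys d k n))

-- (1) The constants 0 and 2^(k-1) agree with F_k exactly where F is 0, resp. 1.
-- (2) Q agrees with F_k exactly where 2^j Q agrees with F_(k+j), so γ_{d,k} ≤ γ_{d,k+j}.
-- (3) Read a best Q modulo q = 2^(k-1). A multilinear polynomial of degree ≤ d over ℤ/q that is not
-- identically zero is nonzero on at least 2^(n-d) points (Schwartz–Zippel, by splitting off x₁), and
-- such points are disagreements. With agreement above 1 - 2^(-d) this forces Q = q Q′ with Q′ ∈ P_{d,1},
-- and Q′ agrees with F_1 where Q agrees with F_k. (4) is (3) for d = 1 unless γ_{1,k} = 1/2, and then
-- (1) and (2) give γ_{1,1} = 1/2 as well.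

module Submission where

open import Defs
open import Algebra.Properties.CommutativeSemigroup using (interchange; x∙yz≈y∙xz)
open import Data.Bool using (Bool; true; false; not; if_then_else_)
open import Data.Bool.Properties using (if-float) renaming (_≟_ to _≟ᵇ_)
open import Data.Empty using (⊥-elim)
open import Data.List using (List; []; _∷_; concatMap; filter; map; length; foldr; zipWith; replicate; upTo)
open import Data.List.Membership.Propositional using (_∈_; lose; find)
open import Data.List.Membership.Propositional.Properties
  using (∈-concatMap⁺; ∈-concatMap⁻; ∈-map⁺; ∈-map⁻; ∈-upTo⁺; ∈-upTo⁻; ∈-filter⁻)
open import Data.List.Properties using (length-map; length-replicate; filter-accept; filter-≐)
open import Data.List.Relation.Unary.All using (All; []; _∷_)
import Data.List.Relation.Unary.All as All
open import Data.List.Relation.Unary.All.Properties using (All¬⇒¬Any) renaming (map⁺ to All-map⁺; replicate⁺ to All-replicate⁺)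
open import Data.List.Relation.Unary.AllPairs using ([]; _∷_)
open import Data.List.Relation.Unary.Any using (here; there)
open import Data.List.Relation.Unary.Unique.Propositional using (Unique)
import Data.List.Relation.Unary.Unique.Propositional.Properties as Unique
open import Data.Nat using (ℕ; zero; suc; _+_; _*_; _^_; _≤_; _<_; _⊔_; z≤n; s≤s; NonZero; _≤?_; _%_; _/_)
open import Data.Nat.DivMod using (%-congˡ; %-congʳ; m%n*o≡m*o%[n*o]; m≡m%n+[m/n]*n; m*[n/m]≡n; m<n*o⇒m/o<n; m<n⇒m%n≡m)
open import Data.Nat.Divisibility using (_∣_; _∣?_; ∣m∣n⇒∣m+n; ∣m+n∣m⇒∣n; ∣n⇒∣m*n; ∣m⇒∣m*n; _∣0; ∣-refl)
open import Data.Nat.ListAction using (sum)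
open import Data.Nat.Properties
open import Data.Product using (_×_; _,_; proj₁; proj₂; ∃-syntax)
open import Data.Sum using (_⊎_; inj₁; inj₂; [_,_])
import Data.Sum as Sum
open import Data.Vec using (Vec; []; _∷_)
import Data.Vec as Vec
open import Data.Vec.Properties using (∷-injectiveʳ; ≡-dec)
open import Function using (_∘_)
open import Function.Bundles using (mk⇔)
open import Relation.Nullary using (yes; no; does; Dec; ¬_)
open import Relation.Nullary.Decidable using (does-⇔; dec-true)
open import Relation.Binary.PropositionalEquality using (_≡_; _≢_; refl; sym; trans; cong; cong₂; subst; subst₂; module ≡-Reasoning)

toℕ : Bool → ℕ
toℕ false = 0
toℕ true  = 1

sumCube : (n : ℕ) → (Vec Bool n → ℕ) → ℕ
sumCube zero    g = g []
sumCube (suc n) g = sumCube n (λ v → g (false ∷ v) + g (true ∷ v))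

sumCube-cong : ∀ n {f g : Vec Bool n → ℕ} → (∀ v → f v ≡ g v) → sumCube n f ≡ sumCube n g
sumCube-cong zero    f≡g = f≡g []
sumCube-cong (suc n) f≡g = sumCube-cong n (λ v → cong₂ _+_ (f≡g _) (f≡g _))

sumCube-mono : ∀ n {f g : Vec Bool n → ℕ} → (∀ v → f v ≤ g v) → sumCube n f ≤ sumCube n g
sumCube-mono zero    f≤g = f≤g []
sumCube-mono (suc n) f≤g = sumCube-mono n (λ v → +-mono-≤ (f≤g _) (f≤g _))

sumCube-+ : ∀ n (f g : Vec Bool n → ℕ) → sumCube n (λ v → f v + g v) ≡ sumCube n f + sumCube n g
sumCube-+ zero    f g = refl
sumCube-+ (suc n) f g = trans
  (sumCube-cong n (λ v → interchange +-commutativeSemigroup (f (false ∷ v)) (g (false ∷ v)) _ _))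
  (sumCube-+ n _ _)

sumCube-* : ∀ n a (f : Vec Bool n → ℕ) → sumCube n (λ v → a * f v) ≡ a * sumCube n f
sumCube-* zero    a f = refl
sumCube-* (suc n) a f = trans (sumCube-cong n (λ v → sym (*-distribˡ-+ a (f (false ∷ v)) _))) (sumCube-* n a _)

sumCube-∣ : ∀ n {q} (f : Vec Bool n → ℕ) → (∀ v → q ∣ f v) → q ∣ sumCube n f
sumCube-∣ zero    f q∣f = q∣f []
sumCube-∣ (suc n) f q∣f = sumCube-∣ n _ (λ v → ∣m∣n⇒∣m+n (q∣f _) (q∣f _))

sumCube-1 : ∀ n → sumCube n (λ _ → 1) ≡ 2 ^ n
sumCube-1 zero    = refl
sumCube-1 (suc n) = trans (sumCube-* n 2 (λ _ → 1)) (cong (2 *_) (sumCube-1 n))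

sum-map-cube : ∀ n (g : Vec Bool n → ℕ) → sum (map g (cube n)) ≡ sumCube n g
sum-map-cube zero    g = +-identityʳ (g [])
sum-map-cube (suc n) g = trans (sum-pairs (cube n)) (sum-map-cube n _)
  where
  sum-pairs : ∀ l → sum (map g (concatMap (λ v → (false ∷ v) ∷ (true ∷ v) ∷ []) l))
                  ≡ sum (map (λ v → g (false ∷ v) + g (true ∷ v)) l)
  sum-pairs []      = refl
  sum-pairs (v ∷ l) = trans (sym (+-assoc (g (false ∷ v)) _ _)) (cong (_ +_) (sum-pairs l))

module _ {A : Set} {P : A → Set} (P? : ∀ x → Dec (P x)) where

  length-filter≡sum : ∀ l → length (filter P? l) ≡ sum (map (toℕ ∘ does ∘ P?) l)
  length-filter≡sum []      = refl
  length-filter≡sum (x ∷ l) with does (P? x)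
  ... | true  = cong suc (length-filter≡sum l)
  ... | false = length-filter≡sum l

length-filter-cube : ∀ n {P : Vec Bool n → Set} (P? : ∀ x → Dec (P x)) →
                     length (filter P? (cube n)) ≡ sumCube n (toℕ ∘ does ∘ P?)
length-filter-cube n P? = trans (length-filter≡sum P? (cube n)) (sum-map-cube n _)

-- Schwartz–Zippel modulo q

eval : ∀ {n} → (Vec Bool n → ℕ) → Vec Bool n → ℕ
eval {n} c x = sumCube n (λ S → c S * monoVal S x)

-- The polynomial with coefficients c is  low c + x₁ · high c.
low high : ∀ {n} → (Vec Bool (suc n) → ℕ) → Vec Bool n → ℕ
low  c S = c (false ∷ S)
high c S = c (true ∷ S)

eval-false : ∀ {n} (c : Vec Bool (suc n) → ℕ) x → eval c (false ∷ x) ≡ eval (low c) x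
eval-false {n} c x = sumCube-cong n (λ S →
  trans (cong (low c S * monoVal S x +_) (*-zeroʳ (high c S))) (+-identityʳ _))

eval-true : ∀ {n} (c : Vec Bool (suc n) → ℕ) x → eval c (true ∷ x) ≡ eval (low c) x + eval (high c) x
eval-true {n} c x = trans
  (sumCube-cong n (λ S → cong (λ m → low c S * monoVal S x + high c S * m) (*-identityˡ (monoVal S x))))
  (sumCube-+ n _ _)

nonMultiple : ℕ → ℕ → ℕ
nonMultiple q m = toℕ (not (does (q ∣? m)))

nonMultiple≤1 : ∀ q m → nonMultiple q m ≤ 1
nonMultiple≤1 q m with q ∣? m
... | yes _ = z≤n
... | no  _ = s≤s z≤n

nonMultiple-multiple : ∀ {q m} → q ∣ m → nonMultiple q m ≡ 0
nonMultiple-multiple {q} {m} q∣m with q ∣? m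
... | yes _   = refl
... | no  q∤m = ⊥-elim (q∤m q∣m)

nonMultiple-+-multiple : ∀ q a {b} → q ∣ b → nonMultiple q (a + b) ≡ nonMultiple q a
nonMultiple-+-multiple q a {b} q∣b = cong (toℕ ∘ not)
  (does-⇔ (mk⇔ (λ q∣a+b → ∣m+n∣m⇒∣n (subst (q ∣_) (+-comm a b) q∣a+b) q∣b) (λ q∣a → ∣m∣n⇒∣m+n q∣a q∣b))
          (q ∣? (a + b)) (q ∣? a))

nonMultiple-≤-+ : ∀ q a b → nonMultiple q b ≤ nonMultiple q a + nonMultiple q (a + b)
nonMultiple-≤-+ q a b with q ∣? b | q ∣? a | q ∣? (a + b)
... | yes _   | _      | _        = z≤n
... | no _    | no _   | _        = s≤s z≤n
... | no _    | yes _  | no _     = s≤s z≤n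
... | no q∤b  | yes q∣a | yes q∣a+b = ⊥-elim (q∤b (∣m+n∣m⇒∣n q∣a+b q∣a))

nonMultiples : ∀ {n} → ℕ → (Vec Bool n → ℕ) → ℕ
nonMultiples {n} q c = sumCube n (λ x → nonMultiple q (eval c x))

nonMultiples-suc : ∀ {n} q (c : Vec Bool (suc n) → ℕ) → nonMultiples q c ≡
  sumCube n (λ v → nonMultiple q (eval (low c) v) + nonMultiple q (eval (low c) v + eval (high c) v))
nonMultiples-suc {n} q c = sumCube-cong n (λ v →
  cong₂ _+_ (cong (nonMultiple q) (eval-false c v)) (cong (nonMultiple q) (eval-true c v)))

nonMultiples-high≤ : ∀ {n} q (c : Vec Bool (suc n) → ℕ) → nonMultiples q (high c) ≤ nonMultiples q c
nonMultiples-high≤ {n} q c = ≤-trans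
  (sumCube-mono n (λ v → nonMultiple-≤-+ q (eval (low c) v) (eval (high c) v)))
  (≤-reflexive (sym (nonMultiples-suc q c)))

nonMultiples-doubling : ∀ {n} q (c : Vec Bool (suc n) → ℕ) → (∀ S → q ∣ high c S) →
                        nonMultiples q c ≡ 2 * nonMultiples q (low c)
nonMultiples-doubling {n} q c q∣high = begin
  nonMultiples q c
    ≡⟨ nonMultiples-suc q c ⟩
  sumCube n (λ v → nonMultiple q (eval (low c) v) + nonMultiple q (eval (low c) v + eval (high c) v))
    ≡⟨ sumCube-cong n (λ v → cong (nonMultiple q (eval (low c) v) +_)
         (trans (nonMultiple-+-multiple q _ (q∣eval-high v)) (sym (+-identityʳ _)))) ⟩
  sumCube n (λ v → 2 * nonMultiple q (eval (low c) v))
    ≡⟨ sumCube-* n 2 _ ⟩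
  2 * nonMultiples q (low c) ∎
  where
  open ≡-Reasoning
  q∣eval-high : ∀ v → q ∣ eval (high c) v
  q∣eval-high v = sumCube-∣ n _ (λ S → ∣m⇒∣m*n (monoVal S v) (q∣high S))

schwartzZippel : ∀ q n d (c : Vec Bool n → ℕ) → (∀ S → d < weight S → q ∣ c S) →
                 (∀ S → q ∣ c S) ⊎ 2 ^ n ≤ 2 ^ d * nonMultiples q c

schwartzZippel-high : ∀ q n d (c : Vec Bool n → ℕ) → (∀ S → d ≤ weight S → q ∣ c S) →
                      (∀ S → q ∣ c S) ⊎ 2 ^ suc n ≤ 2 ^ d * nonMultiples q c

schwartzZippel q zero d c _ with q ∣? c [] * 1
... | yes q∣c = inj₁ λ { [] → subst (q ∣_) (*-identityʳ (c [])) q∣c }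
... | no  _   = inj₂ (subst (1 ≤_) (sym (*-identityʳ (2 ^ d))) (m^n>0 2 d))
schwartzZippel q (suc n) d c h
  with schwartzZippel q n d (low c) (λ S → h (false ∷ S))
     | schwartzZippel-high q n d (high c) (λ S → h (true ∷ S) ∘ s≤s)
... | inj₁ q∣low   | inj₁ q∣high = inj₁ λ { (false ∷ S) → q∣low S ; (true ∷ S) → q∣high S }
... | inj₂ lowBound | inj₁ q∣high = inj₂ (begin
      2 * 2 ^ n                            ≤⟨ *-monoʳ-≤ 2 lowBound ⟩
      2 * (2 ^ d * nonMultiples q (low c)) ≡⟨ x∙yz≈y∙xz *-commutativeSemigroup 2 (2 ^ d) _ ⟩
      2 ^ d * (2 * nonMultiples q (low c)) ≡⟨ cong (2 ^ d *_) (sym (nonMultiples-doubling q c q∣high)) ⟩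
      2 ^ d * nonMultiples q c             ∎)
  where open ≤-Reasoning
... | _ | inj₂ highBound = inj₂ (≤-trans highBound (*-monoʳ-≤ (2 ^ d) (nonMultiples-high≤ q c)))

schwartzZippel-high q n zero    c h = inj₁ λ S → h S z≤n
schwartzZippel-high q n (suc d) c h = Sum.map₂ double (schwartzZippel q n d c h)
  where
  double : 2 ^ n ≤ 2 ^ d * nonMultiples q c → 2 * 2 ^ n ≤ 2 * 2 ^ d * nonMultiples q c
  double b = ≤-trans (*-monoʳ-≤ 2 b) (≤-reflexive (sym (*-assoc 2 (2 ^ d) _)))

_≟ᵥ_ : ∀ {n} (S T : Vec Bool n) → Dec (S ≡ T)
_≟ᵥ_ = ≡-dec _≟ᵇ_

sumCube-point : ∀ n (g : Vec Bool n → ℕ) T → sumCube n (λ S → if does (S ≟ᵥ T) then g S else 0) ≡ g T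
sumCube-point zero    g []          = refl
sumCube-point (suc n) g (false ∷ T) = trans (sumCube-cong n (λ v → +-identityʳ _)) (sumCube-point n _ T)
sumCube-point (suc n) g (true ∷ T)  = sumCube-point n _ T

polySum : ∀ {n} → List (Vec Bool n) → List ℕ → Vec Bool n → ℕ
polySum M cs x = sum (zipWith (λ S c → c * monoVal S x) M cs)

coefficient : ∀ {n} → List (Vec Bool n) → List ℕ → Vec Bool n → ℕ
coefficient (T ∷ M) (c ∷ cs) S = (if does (S ≟ᵥ T) then c else 0) + coefficient M cs S
coefficient _       _        S = 0

polySum≡eval : ∀ {n} (M : List (Vec Bool n)) cs x → polySum M cs x ≡ eval (coefficient M cs) x
polySum≡eval {n} []      cs       x = sym (sumCube-* n 0 (λ T → monoVal T x))
polySum≡eval {n} (T ∷ M) []       x = sym (sumCube-* n 0 (λ T → monoVal T x))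
polySum≡eval {n} (T ∷ M) (c ∷ cs) x = sym (begin
  eval (coefficient (T ∷ M) (c ∷ cs)) x
    ≡⟨ sumCube-cong n (λ S → trans (*-distribʳ-+ (monoVal S x) (if does (S ≟ᵥ T) then c else 0) _)
                                  (cong (_+ _) (if-float (_* monoVal S x) (does (S ≟ᵥ T))))) ⟩
  sumCube n (λ S → (if does (S ≟ᵥ T) then c * monoVal S x else 0) + coefficient M cs S * monoVal S x)
    ≡⟨ sumCube-+ n _ _ ⟩
  _ ≡⟨ cong₂ _+_ (sumCube-point n (λ S → c * monoVal S x) T) (sym (polySum≡eval M cs x)) ⟩
  polySum (T ∷ M) (c ∷ cs) x ∎)
  where open ≡-Reasoning

coefficient-∉ : ∀ {n} (M : List (Vec Bool n)) cs {S} → ¬ S ∈ M → coefficient M cs S ≡ 0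
coefficient-∉ []      cs       S∉ = refl
coefficient-∉ (T ∷ M) []       S∉ = refl
coefficient-∉ (T ∷ M) (c ∷ cs) {S} S∉ with S ≟ᵥ T
... | yes refl = ⊥-elim (S∉ (here refl))
... | no  _    = coefficient-∉ M cs (S∉ ∘ there)

coefficient-highDegree : ∀ d n cs S → d < weight S → coefficient (monomials d n) cs S ≡ 0
coefficient-highDegree d n cs S d<w =
  coefficient-∉ (monomials d n) cs (λ S∈ → <⇒≱ d<w (proj₂ (∈-filter⁻ (λ T → weight T ≤? d) {xs = cube n} S∈)))

coefficient-∣⇒All-∣ : ∀ {n} q (M : List (Vec Bool n)) cs → Unique M → length cs ≡ length M →
                      (∀ S → q ∣ coefficient M cs S) → All (q ∣_) cs
coefficient-∣⇒All-∣ q []      []       _          _   _     = []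
coefficient-∣⇒All-∣ q (T ∷ M) (c ∷ cs) (T∉M ∷ uM) len q∣coef =
  q∣c ∷ coefficient-∣⇒All-∣ q M cs uM (suc-injective len) (λ S → ∣m+n∣m⇒∣n (q∣coef S) (q∣head S))
  where
  q∣c : q ∣ c
  q∣c = subst (q ∣_)
    (trans (cong₂ (λ b r → (if b then c else 0) + r) (dec-true (T ≟ᵥ T) refl) (coefficient-∉ M cs (All¬⇒¬Any T∉M)))
           (+-identityʳ c))
    (q∣coef T)
  q∣head : ∀ S → q ∣ (if does (S ≟ᵥ T) then c else 0)
  q∣head S with does (S ≟ᵥ T)
  ... | true  = q∣c
  ... | false = q ∣0

unique-cube : ∀ n → Unique (cube n)
unique-cube zero    = [] ∷ []
unique-cube (suc n) = pairs (cube n) (unique-cube n)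
  where
  heads-differ : ∀ b (v : Vec Bool n) l → All (v ≢_) l →
                 All ((b ∷ v) ≢_) (concatMap (λ v → (false ∷ v) ∷ (true ∷ v) ∷ []) l)
  heads-differ b v []      []         = []
  heads-differ b v (w ∷ l) (v≢w ∷ ps) = (v≢w ∘ ∷-injectiveʳ) ∷ (v≢w ∘ ∷-injectiveʳ) ∷ heads-differ b v l ps
  pairs : ∀ l → Unique l → Unique (concatMap (λ v → (false ∷ v) ∷ (true ∷ v) ∷ []) l)
  pairs []      []         = []
  pairs (v ∷ l) (v∉l ∷ ul) = ((λ ()) ∷ heads-differ false v l v∉l) ∷ heads-differ true v l v∉l ∷ pairs l ul

unique-monomials : ∀ d n → Unique (monomials d n)
unique-monomials d n = Unique.filter⁺ (λ S → weight S ≤? d) (unique-cube n)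

∈-vectorsBelow⁻ : ∀ q m {cs} → cs ∈ vectorsBelow q m → length cs ≡ m × All (_< q) cs
∈-vectorsBelow⁻ q zero    (here refl) = refl , []
∈-vectorsBelow⁻ q (suc m) cs∈
  with c , c∈ , cs∈′ ← find (∈-concatMap⁻ (λ c → map (c ∷_) (vectorsBelow q m)) {xs = upTo q} cs∈)
  with ds , ds∈ , refl ← ∈-map⁻ (c ∷_) cs∈′
  with len , bounded ← ∈-vectorsBelow⁻ q m ds∈
  = cong suc len , ∈-upTo⁻ {q} c∈ ∷ bounded

∈-vectorsBelow⁺ : ∀ q m {cs} → length cs ≡ m → All (_< q) cs → cs ∈ vectorsBelow q m
∈-vectorsBelow⁺ q zero    {[]}     refl []          = here refl
∈-vectorsBelow⁺ q (suc m) {c ∷ cs} len  (c<q ∷ cs<q) =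
  ∈-concatMap⁺ (λ c → map (c ∷_) (vectorsBelow q m))
    (lose (∈-upTo⁺ c<q) (∈-map⁺ (c ∷_) (∈-vectorsBelow⁺ q m (suc-injective len) cs<q)))

maxOf : {A : Set} → (A → ℕ) → List A → ℕ
maxOf f L = foldr _⊔_ 0 (map f L)

≤-maxOf : ∀ {A : Set} (f : A → ℕ) {L x} → x ∈ L → f x ≤ maxOf f L
≤-maxOf f {x ∷ L} (here refl) = m≤m⊔n (f x) (maxOf f L)
≤-maxOf f {y ∷ L} (there x∈L) = ≤-trans (≤-maxOf f x∈L) (m≤n⊔m (f y) (maxOf f L))

maxOf-lub : ∀ {A : Set} (f : A → ℕ) L {g} → (∀ {x} → x ∈ L → f x ≤ g) → maxOf f L ≤ g
maxOf-lub f []      f≤g = z≤n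
maxOf-lub f (x ∷ L) f≤g = ⊔-lub (f≤g (here refl)) (maxOf-lub f L (f≤g ∘ there))

maxOf-attained : ∀ {A : Set} (f : A → ℕ) L → maxOf f L ≡ 0 ⊎ ∃[ x ] (x ∈ L × maxOf f L ≡ f x)
maxOf-attained f []      = inj₁ refl
maxOf-attained f (x ∷ L) with ⊔-sel (f x) (maxOf f L)
... | inj₁ max≡fx = inj₂ (x , here refl , max≡fx)
... | inj₂ max≡rest with maxOf-attained f L
...   | inj₁ rest≡0             = inj₁ (trans max≡rest rest≡0)
...   | inj₂ (y , y∈L , rest≡fy) = inj₂ (y , there y∈L , trans max≡rest rest≡fy)

-- Changing the modulus

polySum-scale : ∀ {n} q (M : List (Vec Bool n)) cs x → polySum M (map (q *_) cs) x ≡ q * polySum M cs x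
polySum-scale q []      cs       x = sym (*-zeroʳ q)
polySum-scale q (T ∷ M) []       x = sym (*-zeroʳ q)
polySum-scale q (T ∷ M) (c ∷ cs) x =
  trans (cong₂ _+_ (*-assoc q c (monoVal T x)) (polySum-scale q M cs x)) (sym (*-distribˡ-+ q _ _))

2^[1+k+j]≡2^j*2^[1+k] : ∀ k j → 2 ^ suc (k + j) ≡ 2 ^ j * 2 ^ suc k
2^[1+k+j]≡2^j*2^[1+k] k j = trans (^-distribˡ-+-* 2 (suc k) j) (*-comm (2 ^ suc k) (2 ^ j))

evalPoly-scale : ∀ d k j {n} cs (x : Vec Bool n) →
                 evalPoly d (suc (k + j)) (map (2 ^ j *_) cs) x ≡ 2 ^ j * evalPoly d (suc k) cs x
evalPoly-scale d k j {n} cs x = begin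
  polySum M (map (2 ^ j *_) cs) x % 2 ^ suc (k + j)
    ≡⟨ %-congˡ (trans (polySum-scale (2 ^ j) M cs x) (*-comm (2 ^ j) _)) ⟩
  polySum M cs x * 2 ^ j % 2 ^ suc (k + j)
    ≡⟨ %-congʳ (^-distribˡ-+-* 2 (suc k) j) ⟩
  polySum M cs x * 2 ^ j % (2 ^ suc k * 2 ^ j)
    ≡⟨ sym (m%n*o≡m*o%[n*o] (polySum M cs x) (2 ^ suc k) (2 ^ j)) ⟩
  polySum M cs x % 2 ^ suc k * 2 ^ j
    ≡⟨ *-comm _ (2 ^ j) ⟩
  2 ^ j * evalPoly d (suc k) cs x ∎
  where
  open ≡-Reasoning
  M = monomials d n
  instance
    2^[1+k+j]≢0 : NonZero (2 ^ suc (k + j))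
    2^[1+k+j]≢0 = m^n≢0 2 (suc (k + j))
    2^[1+k]≢0 : NonZero (2 ^ suc k)
    2^[1+k]≢0 = m^n≢0 2 (suc k)
    2^[1+k]*2^j≢0 : NonZero (2 ^ suc k * 2 ^ j)
    2^[1+k]*2^j≢0 = m*n≢0 (2 ^ suc k) (2 ^ j) {{m^n≢0 2 (suc k)}} {{m^n≢0 2 j}}

liftk-scale : ∀ k j b → liftk (suc (k + j)) b ≡ 2 ^ j * liftk (suc k) b
liftk-scale k j false = sym (*-zeroʳ (2 ^ j))
liftk-scale k j true  = trans (^-distribˡ-+-* 2 k j) (*-comm (2 ^ k) (2 ^ j))

agrCount-scale : ∀ d k j {n} (F : Vec Bool n → Bool) cs →
                 agrCount d (suc (k + j)) F (map (2 ^ j *_) cs) ≡ agrCount d (suc k) F cs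
agrCount-scale d k j {n} F cs = cong length (filter-≐ _ _ (unscale , scale) (cube n))
  where
  unscale : ∀ {x} → liftk (suc (k + j)) (F x) ≡ evalPoly d (suc (k + j)) (map (2 ^ j *_) cs) x →
            liftk (suc k) (F x) ≡ evalPoly d (suc k) cs x
  unscale {x} e = *-cancelˡ-≡ _ _ (2 ^ j) {{m^n≢0 2 j}}
    (trans (sym (liftk-scale k j (F x))) (trans e (evalPoly-scale d k j cs x)))
  scale : ∀ {x} → liftk (suc k) (F x) ≡ evalPoly d (suc k) cs x →
          liftk (suc (k + j)) (F x) ≡ evalPoly d (suc (k + j)) (map (2 ^ j *_) cs) x
  scale {x} e = trans (liftk-scale k j (F x)) (trans (cong (2 ^ j *_) e) (sym (evalPoly-scale d k j cs x)))

scale∈polys : ∀ d k j {n cs} → cs ∈ polys d (suc k) n → map (2 ^ j *_) cs ∈ polys d (suc (k + j)) n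
scale∈polys d k j {n} {cs} cs∈ with len , bounded ← ∈-vectorsBelow⁻ (2 ^ suc k) (length (monomials d n)) cs∈ =
  ∈-vectorsBelow⁺ (2 ^ suc (k + j)) (length (monomials d n)) (trans (length-map _ cs) len)
    (All-map⁺ (All.map (λ {c} c< → subst (2 ^ j * c <_) (sym (2^[1+k+j]≡2^j*2^[1+k] k j))
                                       (*-monoʳ-< (2 ^ j) {{m^n≢0 2 j}} c<)) bounded))

gammaCount-mono : ∀ d k j {n} (F : Vec Bool n → Bool) → gammaCount d (suc k) F ≤ gammaCount d (suc (k + j)) F
gammaCount-mono d k j {n} F = maxOf-lub (agrCount d (suc k) F) (polys d (suc k) n) λ {cs} cs∈ →
  subst (_≤ gammaCount d (suc (k + j)) F) (agrCount-scale d k j F cs)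
        (≤-maxOf (agrCount d (suc (k + j)) F) (scale∈polys d k j {n} cs∈))

zeros : ∀ n → Vec Bool n
zeros n = Vec.replicate n false

weight-zeros : ∀ n → weight (zeros n) ≡ 0
weight-zeros zero    = refl
weight-zeros (suc n) = weight-zeros n

monoVal-zeros : ∀ {n} (x : Vec Bool n) → monoVal (zeros n) x ≡ 1
monoVal-zeros []      = refl
monoVal-zeros (_ ∷ x) = monoVal-zeros x

cube-head : ∀ n → ∃[ r ] cube n ≡ zeros n ∷ r
cube-head zero = [] , refl
cube-head (suc n) with cube-head n
... | _ , e rewrite e = _ , refl

monomials-head : ∀ d n → ∃[ M ] monomials d n ≡ zeros n ∷ M
monomials-head d n = _ , trans (cong (filter (λ S → weight S ≤? d)) (proj₂ (cube-head n)))
  (filter-accept (λ S → weight S ≤? d) (subst (_≤ d) (sym (weight-zeros n)) z≤n))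

polySum-zeros : ∀ {n} (M : List (Vec Bool n)) m x → polySum M (replicate m 0) x ≡ 0
polySum-zeros []      m       x = refl
polySum-zeros (T ∷ M) zero    x = refl
polySum-zeros (T ∷ M) (suc m) x = polySum-zeros M m x

constant : ∀ {n} → List (Vec Bool n) → ℕ → List ℕ
constant M c = c ∷ replicate (length M) 0

module _ (d k : ℕ) {n : ℕ} {M : List (Vec Bool n)} (monomials≡ : monomials d n ≡ zeros n ∷ M)
         {c : ℕ} (c<2^k : c < 2 ^ k) where

  evalPoly-constant : ∀ x → evalPoly d k (constant M c) x ≡ c
  evalPoly-constant x = trans (%-congˡ {{m^n≢0 2 k}} polySum≡c) (m<n⇒m%n≡m {{m^n≢0 2 k}} c<2^k)
    where
    polySum≡c : polySum (monomials d n) (constant M c) x ≡ c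
    polySum≡c rewrite monomials≡ | monoVal-zeros x | polySum-zeros M (length M) x = trans (+-identityʳ _) (*-identityʳ c)

  constant∈polys : constant M c ∈ polys d k n
  constant∈polys = ∈-vectorsBelow⁺ (2 ^ k) (length (monomials d n))
    (trans (cong suc (length-replicate (length M))) (sym (cong length monomials≡)))
    (c<2^k ∷ All-replicate⁺ (length M) (m^n>0 2 k))

1≤toℕ-does-⊎ : ∀ {P Q : Set} (P? : Dec P) (Q? : Dec Q) → P ⊎ Q → 1 ≤ toℕ (does P?) + toℕ (does Q?)
1≤toℕ-does-⊎ (yes _)  _        _   = s≤s z≤n
1≤toℕ-does-⊎ (no _)   (yes _)  _   = s≤s z≤n
1≤toℕ-does-⊎ (no ¬p)  (no ¬q)  p⊎q = ⊥-elim ([ ¬p , ¬q ] p⊎q)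

gammaCount-≥-half : ∀ d k {n} (F : Vec Bool n → Bool) → 2 ^ n ≤ 2 * gammaCount d (suc k) F
gammaCount-≥-half d k {n} F = begin
  2 ^ n                                      ≡⟨ sym (sumCube-1 n) ⟩
  sumCube n (λ _ → 1)                        ≤⟨ sumCube-mono n (λ x → 1≤toℕ-does-⊎ (agrees null x) (agrees half x) (lift-cases x (F x) refl)) ⟩
  sumCube n (λ x → matches null x + matches half x) ≡⟨ sumCube-+ n _ _ ⟩
  sumCube n (matches null) + sumCube n (matches half)
    ≡⟨ sym (cong₂ _+_ (length-filter-cube n (agrees null)) (length-filter-cube n (agrees half))) ⟩
  agrCount d (suc k) F null + agrCount d (suc k) F half
    ≤⟨ +-mono-≤ (≤-maxOf (agrCount d (suc k) F) (constant∈polys d (suc k) monomials≡ 0<2^[1+k]))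
                (≤-maxOf (agrCount d (suc k) F) (constant∈polys d (suc k) monomials≡ 2^k<2^[1+k])) ⟩
  γ + γ                                      ≡⟨ cong (γ +_) (sym (+-identityʳ γ)) ⟩
  2 * γ                                      ∎
  where
  open ≤-Reasoning
  γ = gammaCount d (suc k) F
  M = proj₁ (monomials-head d n)
  monomials≡ = proj₂ (monomials-head d n)
  null half : List ℕ
  null = constant M 0
  half = constant M (2 ^ k)
  0<2^[1+k] : 0 < 2 ^ suc k
  0<2^[1+k] = m^n>0 2 (suc k)
  2^k<2^[1+k] : 2 ^ k < 2 ^ suc k
  2^k<2^[1+k] = ^-monoʳ-< 2 (s≤s (s≤s z≤n)) (n<1+n k)
  agrees : (cs : List ℕ) (x : Vec Bool n) → Dec (liftk (suc k) (F x) ≡ evalPoly d (suc k) cs x)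
  agrees cs x = liftk (suc k) (F x) ≟ evalPoly d (suc k) cs x
  matches : List ℕ → Vec Bool n → ℕ
  matches cs x = toℕ (does (agrees cs x))
  lift-cases : ∀ x b → F x ≡ b →
    liftk (suc k) (F x) ≡ evalPoly d (suc k) null x ⊎ liftk (suc k) (F x) ≡ evalPoly d (suc k) half x
  lift-cases x false Fx≡b = inj₁ (trans (cong (liftk (suc k)) Fx≡b) (sym (evalPoly-constant d (suc k) monomials≡ 0<2^[1+k] x)))
  lift-cases x true  Fx≡b = inj₂ (trans (cong (liftk (suc k)) Fx≡b) (sym (evalPoly-constant d (suc k) monomials≡ 2^k<2^[1+k] x)))

-- Large agreement

∣-%⇒∣ : ∀ {q} m s .{{_ : NonZero m}} → q ∣ m → q ∣ s % m → q ∣ s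
∣-%⇒∣ m s q∣m q∣s%m = subst (_ ∣_) (sym (m≡m%n+[m/n]*n s m)) (∣m∣n⇒∣m+n q∣s%m (∣n⇒∣m*n (s / m) q∣m))

2^k∣liftk : ∀ k b → 2 ^ k ∣ liftk (suc k) b
2^k∣liftk k false = (2 ^ k) ∣0
2^k∣liftk k true  = ∣-refl

toℕ-does+≤1 : ∀ {P : Set} (P? : Dec P) {m} → m ≤ 1 → (P → m ≡ 0) → toℕ (does P?) + m ≤ 1
toℕ-does+≤1 (yes p) m≤1 m≡0 = ≤-reflexive (cong suc (m≡0 p))
toℕ-does+≤1 (no _)  m≤1 m≡0 = m≤1

-- F_(k+1) takes values in {0, 2^k}, so Q is a multiple of 2^k wherever it agrees with F_(k+1).
agrCount+nonMultiples≤2^n : ∀ d k {n} (F : Vec Bool n → Bool) cs →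
  agrCount d (suc k) F cs + nonMultiples (2 ^ k) (coefficient (monomials d n) cs) ≤ 2 ^ n
agrCount+nonMultiples≤2^n d k {n} F cs = begin
  agrCount d (suc k) F cs + nonMultiples (2 ^ k) c
    ≡⟨ cong (_+ nonMultiples (2 ^ k) c) (length-filter-cube n agrees) ⟩
  sumCube n (toℕ ∘ does ∘ agrees) + nonMultiples (2 ^ k) c
    ≡⟨ sym (sumCube-+ n _ _) ⟩
  sumCube n (λ x → toℕ (does (agrees x)) + nonMultiple (2 ^ k) (eval c x))
    ≤⟨ sumCube-mono n (λ x → toℕ-does+≤1 (agrees x) (nonMultiple≤1 (2 ^ k) (eval c x)) (nonMultiple-multiple ∘ 2^k∣eval x)) ⟩
  sumCube n (λ _ → 1)
    ≡⟨ sumCube-1 n ⟩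
  2 ^ n ∎
  where
  open ≤-Reasoning
  c = coefficient (monomials d n) cs
  agrees : (x : Vec Bool n) → Dec (liftk (suc k) (F x) ≡ evalPoly d (suc k) cs x)
  agrees x = liftk (suc k) (F x) ≟ evalPoly d (suc k) cs x
  2^k∣eval : ∀ x → liftk (suc k) (F x) ≡ evalPoly d (suc k) cs x → 2 ^ k ∣ eval c x
  2^k∣eval x agree = subst (2 ^ k ∣_) (polySum≡eval (monomials d n) cs x)
    (∣-%⇒∣ (2 ^ suc k) _ {{m^n≢0 2 (suc k)}} (∣n⇒∣m*n 2 ∣-refl) (subst (2 ^ k ∣_) agree (2^k∣liftk k (F x))))

map-*-/ : ∀ q .{{_ : NonZero q}} {cs} → All (q ∣_) cs → map (q *_) (map (_/ q) cs) ≡ cs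
map-*-/ q []          = refl
map-*-/ q (q∣c ∷ q∣cs) = cong₂ _∷_ (m*[n/m]≡n q∣c) (map-*-/ q q∣cs)

agrCount≤gammaCount1-divisible : ∀ d k {n} (F : Vec Bool n → Bool) cs → cs ∈ polys d (suc k) n →
                                 All (2 ^ k ∣_) cs → agrCount d (suc k) F cs ≤ gammaCount d 1 F
agrCount≤gammaCount1-divisible d k {n} F cs cs∈ 2^k∣cs
  with len , bounded ← ∈-vectorsBelow⁻ (2 ^ suc k) (length (monomials d n)) cs∈ = begin
  agrCount d (suc k) F cs                          ≡⟨ cong (agrCount d (suc k) F) (sym (map-*-/ (2 ^ k) 2^k∣cs)) ⟩
  agrCount d (suc k) F (map (2 ^ k *_) reduced)    ≡⟨ agrCount-scale d 0 k F reduced ⟩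
  agrCount d 1 F reduced                           ≤⟨ ≤-maxOf (agrCount d 1 F) reduced∈ ⟩
  gammaCount d 1 F                                 ∎
  where
  open ≤-Reasoning
  instance
    2^k≢0 : NonZero (2 ^ k)
    2^k≢0 = m^n≢0 2 k
  reduced : List ℕ
  reduced = map (_/ 2 ^ k) cs
  reduced∈ : reduced ∈ polys d 1 n
  reduced∈ = ∈-vectorsBelow⁺ 2 (length (monomials d n)) (trans (length-map _ cs) len)
    (All-map⁺ (All.map m<n*o⇒m/o<n bounded))

agrCount≤gammaCount1 : ∀ d k {n} (F : Vec Bool n → Bool) cs → cs ∈ polys d (suc k) n →
                       2 ^ n * 2 ^ d < agrCount d (suc k) F cs * 2 ^ d + 2 ^ n →
                       agrCount d (suc k) F cs ≤ gammaCount d 1 F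
agrCount≤gammaCount1 d k {n} F cs cs∈ many
  with schwartzZippel (2 ^ k) n d (coefficient (monomials d n) cs)
         (λ S d<w → subst (2 ^ k ∣_) (sym (coefficient-highDegree d n cs S d<w)) ((2 ^ k) ∣0))
... | inj₁ 2^k∣coef = agrCount≤gammaCount1-divisible d k F cs cs∈
  (coefficient-∣⇒All-∣ (2 ^ k) (monomials d n) cs (unique-monomials d n) (proj₁ (∈-vectorsBelow⁻ _ _ cs∈)) 2^k∣coef)
... | inj₂ bound = ⊥-elim (<⇒≱ many (begin
  agr * D + 2 ^ n  ≤⟨ +-monoʳ-≤ (agr * D) (subst (2 ^ n ≤_) (*-comm D N) bound) ⟩
  agr * D + N * D  ≡⟨ sym (*-distribʳ-+ D agr N) ⟩
  (agr + N) * D    ≤⟨ *-monoˡ-≤ D (agrCount+nonMultiples≤2^n d k F cs) ⟩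
  2 ^ n * D        ∎))
  where
  open ≤-Reasoning
  agr = agrCount d (suc k) F cs
  D = 2 ^ d
  N = nonMultiples (2 ^ k) (coefficient (monomials d n) cs)

gammaCount≡gammaCount1 : ∀ d k {n} (F : Vec Bool n → Bool) →
                         2 ^ n * 2 ^ d < gammaCount d (suc k) F * 2 ^ d + 2 ^ n →
                         gammaCount d (suc k) F ≡ gammaCount d 1 F
gammaCount≡gammaCount1 d k {n} F many = ≤-antisym upper (gammaCount-mono d 0 k F)
  where
  upper : gammaCount d (suc k) F ≤ gammaCount d 1 F
  upper with maxOf-attained (agrCount d (suc k) F) (polys d (suc k) n)
  ... | inj₁ γ≡0 = subst (_≤ gammaCount d 1 F) (sym γ≡0) z≤n
  ... | inj₂ (cs , cs∈ , γ≡agr) = subst (_≤ gammaCount d 1 F) (sym γ≡agr)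
    (agrCount≤gammaCount1 d k F cs cs∈ (subst (λ γ → 2 ^ n * 2 ^ d < γ * 2 ^ d + 2 ^ n) γ≡agr many))

gammaCount-degree1≡gammaCount1 : ∀ k {n} (F : Vec Bool n → Bool) → gammaCount 1 (suc k) F ≡ gammaCount 1 1 F
gammaCount-degree1≡gammaCount1 k {n} F with m≤n⇒m<n∨m≡n (gammaCount-≥-half 1 k F)
... | inj₁ 2^n<2γ = gammaCount≡gammaCount1 1 k F
  (subst₂ _<_ (m+m≡m*2 (2 ^ n)) (cong (_+ 2 ^ n) (*-comm 2 γ)) (+-monoˡ-< (2 ^ n) 2^n<2γ))
  where
  γ = gammaCount 1 (suc k) F
  m+m≡m*2 : ∀ m → m + m ≡ m * 2
  m+m≡m*2 m = trans (cong (m +_) (sym (+-identityʳ m))) (*-comm 2 m)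
... | inj₂ 2^n≡2γ = ≤-antisym
  (*-cancelˡ-≤ 2 (subst (_≤ 2 * gammaCount 1 1 F) 2^n≡2γ (gammaCount-≥-half 1 0 F)))
  (gammaCount-mono 1 0 k F)

lemma2p6 : (n d k : ℕ) → 1 ≤ n → 1 ≤ k → (F : Vec Bool n → Bool) →
    (2 ^ n ≤ 2 * gammaCount d k F)
    × (gammaCount d k F ≤ gammaCount d (suc k) F)
    × (2 ^ n * 2 ^ d < gammaCount d k F * 2 ^ d + 2 ^ n →
         gammaCount d k F ≡ gammaCount d 1 F)
    × (gammaCount 1 k F ≡ gammaCount 1 1 F)
lemma2p6 n d (suc k) _ (s≤s z≤n) F =
    gammaCount-≥-half d k F
  , subst (λ m → gammaCount d (suc k) F ≤ gammaCount d (suc m) F) (+-comm k 1) (gammaCount-mono d k 1 F)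
  , gammaCount≡gammaCount1 d k F
  , gammaCount-degree1≡gammaCount1 k F
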